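{- Let $G$ be a finite simple graph of order $2n$ with a perfect matching. If $F(G)=n-1$ or $F(G)=n-2$, then $e(G)\geq \frac{n^2}{n-F(G)}$.
   Context: For a graph $G$ with a perfect matching $M$, a subset $S\subseteq M$ is a forcing set of $M$ if $S$ is contained in no perfect matching of $G$ other than $M$. $f(G,M)$ is the minimum size of a forcing set of $M$, and $F(G)=\max_M f(G,M)$ over all perfect matchings $M$ of $G$. $e(G)$ is the number of edges. -}

module Defs where

open import Data.Nat using (ℕ; _<ᵇ_; _≤_; _+_; _*_; _∸_)
open import Data.Bool using (Bool; true; false; _∧_)
open import Data.Fin using (Fin; toℕ)
open import Data.List using (List; length; filterᵇ; allFin; concatMap; map)
open import Data.Product using (_×_; _,_; Σ; ∃)
open import Relation.Binary.PropositionalEquality using (_≡_; _≢_)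

record Graph (v : ℕ) : Set where
  field
    adj    : Fin v → Fin v → Bool
    sym    : ∀ i j → adj i j ≡ adj j i
    irrefl : ∀ i → adj i i ≡ false
open Graph public

pairs : (v : ℕ) → List (Fin v × Fin v)
pairs v = concatMap (λ i → map (i ,_) (allFin v)) (allFin v)

numEdges : ∀ {v} → Graph v → ℕ
numEdges {v} G = length (filterᵇ (λ p → (toℕ (Data.Product.proj₁ p) <ᵇ toℕ (Data.Product.proj₂ p)) ∧ adj G (Data.Product.proj₁ p) (Data.Product.proj₂ p)) (pairs v))

-- A perfect matching M of G, encoded by the partner map: every vertex i is
-- matched by the edge {i, partner i} of G; the edges {i, partner i} are
-- pairwise disjoint and cover every vertex exactly once.
record PerfectMatching {v : ℕ} (G : Graph v) : Set where
  field
    partner   : Fin v → Fin v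
    invol     : ∀ i → partner (partner i) ≡ i
    noFix     : ∀ i → partner i ≢ i
    isEdge    : ∀ i → adj G i (partner i) ≡ true
open PerfectMatching public

SameMatching : ∀ {v} {G : Graph v} → PerfectMatching G → PerfectMatching G → Set
SameMatching M M' = ∀ i → partner M i ≡ partner M' i

-- A subset S of the edges of M, encoded by marking the endpoints of the
-- chosen edges (both endpoints of an edge of M are marked or neither).
record EdgeSubset {v : ℕ} {G : Graph v} (M : PerfectMatching G) : Set where
  field
    mark   : Fin v → Bool
    closed : ∀ i → mark i ≡ mark (partner M i)
open EdgeSubset public

size : ∀ {v} {G : Graph v} {M : PerfectMatching G} → EdgeSubset M → ℕ
size {v} {M = M} S = length (filterᵇ (λ i → mark S i ∧ (toℕ i <ᵇ toℕ (partner M i))) (allFin v))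

IsForcing : ∀ {v} {G : Graph v} (M : PerfectMatching G) → EdgeSubset M → Set
IsForcing {G = G} M S =
  (M' : PerfectMatching G) →
  (∀ i → mark S i ≡ true → partner M' i ≡ partner M i) →
  SameMatching M' M

ForcingNumber : ∀ {v} {G : Graph v} → PerfectMatching G → ℕ → Set
ForcingNumber M k =
  (Σ (EdgeSubset M) λ S → IsForcing M S × size S ≡ k) ×
  (∀ (S : EdgeSubset M) → IsForcing M S → k ≤ size S)

MaxForcingNumber : ∀ {v} → Graph v → ℕ → Set
MaxForcingNumber G k =
  (Σ (PerfectMatching G) λ M → ForcingNumber M k) ×
  (∀ (M : PerfectMatching G) (j : ℕ) → ForcingNumber M j → j ≤ k)

-- Fix a perfect matching M with f(G,M) = F, and for vertices x, y let e(x, y) be the number of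
-- edges of G between the M-edges through x and y. Take k ≤ 3 edges of M that are pairwise joined
-- by at most one edge of G and contain no triangle of joined pairs. Deleting them from M leaves a
-- forcing set of size n - k: a perfect matching M' ≠ M containing it would have to alternate
-- around a cycle of these M-edges, which needs two edges between two of them or a triangle.
-- If F = n - 1, the case k = 2 gives e(x, y) ≥ 2 for all x, y, and Σ_{x,y} e(x, y) = 8 e(G).
-- If F = n - 2, the case k = 3 shows that two M-edges joined by at most one edge send at least
-- two edges to every other M-edge. Removing such pairs one at a time gives
-- Σ_{x,y ∈ X} e(x, y) ≥ |X|² for every union X of M-edges, hence 8 e(G) ≥ (2n)².

module Submission where

open import Defs hiding (sym)
open import Data.Bool using (Bool; true; false; _∧_; _∨_; not; T?)
open import Data.Bool.Properties using (∧-zeroʳ) renaming (_≟_ to _≟ᵇ_)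
open import Data.Empty using (⊥; ⊥-elim)
open import Data.Fin using (Fin; zero; suc; toℕ)
open import Data.Fin.Patterns using (0F; 1F; 2F; 3F)
open import Data.Fin.Permutation using (permutation)
open import Data.Fin.Properties using (_≟_; toℕ-injective; suc-injective; 0≢1+n; any?; pigeonhole)
open import Data.List using (List; _++_; length; filterᵇ; map; concat; tabulate; allFin)
open import Data.List.Properties using (filter-++; length-++; map-tabulate)
open import Data.Nat using (ℕ; zero; suc; _+_; _*_; _∸_; _≤_; _<_; _≤?_; _<ᵇ_; z≤n; s≤s)
open import Data.Nat.Induction using (<-rec)
open import Data.Nat.Properties
  using (+-*-semiring; +-identityʳ; +-suc; +-mono-≤; +-monoˡ-≤; +-monoʳ-≤; +-cancelˡ-≤;
         *-identityˡ; *-identityʳ; *-assoc; *-distribˡ-+; *-distribʳ-+; *-monoˡ-≤; *-monoʳ-≤;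
         *-cancelˡ-≡; *-cancelˡ-≤; ≤-refl; ≤-reflexive; ≤-trans; ≤-pred; ≰⇒>; m≤m+n; m≤n+m;
         m<m+n; m+n∸m≡n; +-assoc; module ≤-Reasoning)
open import Data.Nat.Tactic.RingSolver using (solve-∀)
open import Data.Product using (_×_; _,_; proj₁; proj₂; ∃)
open import Data.Sum using (_⊎_; inj₁; inj₂)
open import Function using (_∘_; id; Injective; case_of_; mk⇔)
open import Relation.Binary.PropositionalEquality
open import Relation.Nullary using (¬_; Dec; does; yes; no)
open import Relation.Nullary.Decidable using (_⊎-dec_; _×-dec_; dec-true; dec-false; does-⇔)
open import Algebra.Properties.Semiring.Sum +-*-semiring
  using (sum; sum-syntax; sum-cong-≗; sum-replicate-zero; ∑-distrib-+; ∑-comm; ∑-permute;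
         *-distribˡ-sum; *-distribʳ-sum)

⟦_⟧ : Bool → ℕ
⟦ true ⟧  = 1
⟦ false ⟧ = 0

⟦∧⟧ : ∀ b c → ⟦ b ∧ c ⟧ ≡ ⟦ b ⟧ * ⟦ c ⟧
⟦∧⟧ true  c = sym (+-identityʳ ⟦ c ⟧)
⟦∧⟧ false c = refl

⟦⟧*-mono : ∀ b {m n} → (b ≡ true → m ≤ n) → ⟦ b ⟧ * m ≤ ⟦ b ⟧ * n
⟦⟧*-mono true  m≤n = *-monoʳ-≤ 1 (m≤n refl)
⟦⟧*-mono false _   = z≤n

⟦⟧-split : ∀ b c → (c ≡ true → b ≡ true) → ⟦ b ⟧ ≡ ⟦ not c ∧ b ⟧ + ⟦ c ⟧
⟦⟧-split b false _   = sym (+-identityʳ ⟦ b ⟧)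
⟦⟧-split b true  c⇒b rewrite c⇒b refl = refl

⟦⟧-partition : ∀ b c → ⟦ not c ∧ b ⟧ + ⟦ c ∧ b ⟧ ≡ ⟦ b ⟧
⟦⟧-partition b true  = refl
⟦⟧-partition b false = +-identityʳ ⟦ b ⟧

sum≤1⇒zero : ∀ m n → m + n ≤ 1 → m ≡ 0 ⊎ n ≡ 0
sum≤1⇒zero zero    n       _         = inj₁ refl
sum≤1⇒zero (suc m) zero    _         = inj₂ refl
sum≤1⇒zero (suc m) (suc n) (s≤s m+n) = case ≤-trans (≤-reflexive (sym (+-suc m n))) m+n of λ ()

∸-of-+ : ∀ {m d n} → m + d ≡ n → n ∸ m ≡ d
∸-of-+ {m} {d} refl = m+n∸m≡n m d

<ᵇ-exclusive : ∀ m n → m ≢ n → ⟦ m <ᵇ n ⟧ + ⟦ n <ᵇ m ⟧ ≡ 1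
<ᵇ-exclusive zero    zero    m≢n = ⊥-elim (m≢n refl)
<ᵇ-exclusive zero    (suc n) _   = refl
<ᵇ-exclusive (suc m) zero    _   = refl
<ᵇ-exclusive (suc m) (suc n) m≢n = <ᵇ-exclusive m n (m≢n ∘ cong suc)

_<ᶠ_ : ∀ {v} → Fin v → Fin v → Bool
i <ᶠ j = toℕ i <ᵇ toℕ j

<ᶠ-exclusive : ∀ {v} {i j : Fin v} → i ≢ j → ⟦ i <ᶠ j ⟧ + ⟦ j <ᶠ i ⟧ ≡ 1
<ᶠ-exclusive {i = i} {j} i≢j = <ᵇ-exclusive (toℕ i) (toℕ j) (i≢j ∘ toℕ-injective)

<ᶠ-flip : ∀ {v} {i j : Fin v} → i ≢ j → i <ᶠ j ≡ false → j <ᶠ i ≡ true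
<ᶠ-flip {i = i} {j} i≢j i≮j with j <ᶠ i | <ᶠ-exclusive i≢j
... | true  | _ = refl
... | false | e rewrite i≮j = case e of λ ()

among-three : ∀ {k} → k ≤ 3 → {c₁ c₂ c₃ : Fin k} → c₁ ≢ c₂ → c₁ ≢ c₃ → c₂ ≢ c₃ →
              ∀ c → c ≡ c₁ ⊎ c ≡ c₂ ⊎ c ≡ c₃
among-three k≤3 {c₁} {c₂} {c₃} c₁≢c₂ c₁≢c₃ c₂≢c₃ c with pigeonhole (s≤s k≤3) tuple
  where
  tuple : Fin 4 → Fin _
  tuple 0F = c₁
  tuple 1F = c₂
  tuple 2F = c₃
  tuple 3F = c
... | 0F , 1F , _ , e = ⊥-elim (c₁≢c₂ e)
... | 0F , 2F , _ , e = ⊥-elim (c₁≢c₃ e)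
... | 1F , 2F , _ , e = ⊥-elim (c₂≢c₃ e)
... | 0F , 3F , _ , e = inj₁ (sym e)
... | 1F , 3F , _ , e = inj₂ (inj₁ (sym e))
... | 2F , 3F , _ , e = inj₂ (inj₂ (sym e))
... | 1F , 1F , s≤s () , _
... | suc (suc _) , 1F , s≤s () , _
... | suc (suc _) , 2F , s≤s (s≤s ()) , _
... | suc (suc (suc _)) , 3F , s≤s (s≤s (s≤s ())) , _

no-three-distinct : ∀ {k} → k ≤ 2 → {c₁ c₂ c₃ : Fin k} → c₁ ≢ c₂ → c₁ ≢ c₃ → c₂ ≢ c₃ → ⊥
no-three-distinct k≤2 {c₁} {c₂} {c₃} c₁≢c₂ c₁≢c₃ c₂≢c₃ with pigeonhole (s≤s k≤2) tuple
  where
  tuple : Fin 3 → Fin _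
  tuple 0F = c₁
  tuple 1F = c₂
  tuple 2F = c₃
... | 0F , 1F , _ , e = c₁≢c₂ e
... | 0F , 2F , _ , e = c₁≢c₃ e
... | 1F , 2F , _ , e = c₂≢c₃ e
... | suc _ , 1F , s≤s () , _
... | suc (suc _) , 2F , s≤s (s≤s ()) , _

module _ {A : Set} (R : A → A → Set) (R-sym : ∀ {a b} → R a b → R b a) where

  pairwise-Fin2 : ∀ (f : Fin 2 → A) → R (f 0F) (f 1F) → ∀ {i j} → i ≢ j → R (f i) (f j)
  pairwise-Fin2 f R01 {0F} {0F} i≢j = ⊥-elim (i≢j refl)
  pairwise-Fin2 f R01 {0F} {1F} _   = R01
  pairwise-Fin2 f R01 {1F} {0F} _   = R-sym R01
  pairwise-Fin2 f R01 {1F} {1F} i≢j = ⊥-elim (i≢j refl)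

  pairwise-Fin3 : ∀ (f : Fin 3 → A) → R (f 0F) (f 1F) → R (f 0F) (f 2F) → R (f 1F) (f 2F) →
                  ∀ {i j} → i ≢ j → R (f i) (f j)
  pairwise-Fin3 f R01 R02 R12 {0F} {1F} _ = R01
  pairwise-Fin3 f R01 R02 R12 {0F} {2F} _ = R02
  pairwise-Fin3 f R01 R02 R12 {1F} {2F} _ = R12
  pairwise-Fin3 f R01 R02 R12 {1F} {0F} _ = R-sym R01
  pairwise-Fin3 f R01 R02 R12 {2F} {0F} _ = R-sym R02
  pairwise-Fin3 f R01 R02 R12 {2F} {1F} _ = R-sym R12
  pairwise-Fin3 f R01 R02 R12 {0F} {0F} i≢j = ⊥-elim (i≢j refl)
  pairwise-Fin3 f R01 R02 R12 {1F} {1F} i≢j = ⊥-elim (i≢j refl)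
  pairwise-Fin3 f R01 R02 R12 {2F} {2F} i≢j = ⊥-elim (i≢j refl)

δ : ∀ {v} → Fin v → Fin v → ℕ
δ a i = ⟦ does (i ≟ a) ⟧

sum-mono-≤ : ∀ {v} {f g : Fin v → ℕ} → (∀ i → f i ≤ g i) → sum f ≤ sum g
sum-mono-≤ {zero}  f≤g = z≤n
sum-mono-≤ {suc v} f≤g = +-mono-≤ (f≤g zero) (sum-mono-≤ (f≤g ∘ suc))

sum-const : ∀ v c → ∑[ i < v ] c ≡ v * c
sum-const zero    c = refl
sum-const (suc v) c = cong (c +_) (sum-const v c)

sum-δ : ∀ {v} (a : Fin v) (f : Fin v → ℕ) → ∑[ i < v ] (δ a i * f i) ≡ f a
sum-δ {suc v} zero f = trans (cong₂ _+_ (*-identityˡ (f zero)) (sum-replicate-zero v)) (+-identityʳ (f zero))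
sum-δ {suc v} (suc a) f = sum-δ a (f ∘ suc)

sum-involution : ∀ {v} (p : Fin v → Fin v) → (∀ i → p (p i) ≡ i) →
                 (f : Fin v → ℕ) → sum f ≡ ∑[ i < v ] f (p i)
sum-involution p p∘p f = ∑-permute f (permutation p p p∘p p∘p)

multiplicity-injective : ∀ {k v} (h : Fin k → Fin v) → Injective _≡_ _≡_ h →
                         ∀ i → ∑[ c < k ] δ (h c) i ≤ 1
multiplicity-injective {zero}  h h-inj i = z≤n
multiplicity-injective {suc k} h h-inj i with i ≟ h zero
... | no _  = multiplicity-injective (h ∘ suc) (suc-injective ∘ h-inj) i
... | yes refl = ≤-reflexive (cong suc (trans (sum-cong-≗ missed) (sum-replicate-zero k)))
  where
  missed : ∀ c → δ (h (suc c)) (h zero) ≡ 0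
  missed c = cong ⟦_⟧ (dec-false (h zero ≟ h (suc c)) (0≢1+n ∘ h-inj))

sum-injective-≤ : ∀ {k v} (h : Fin k → Fin v) → Injective _≡_ _≡_ h →
                  (g : Fin v → ℕ) → ∑[ c < k ] g (h c) ≤ sum g
sum-injective-≤ {k} {v} h h-inj g = begin
  ∑[ c < k ] g (h c)
    ≡⟨ sum-cong-≗ (λ c → sym (sum-δ (h c) g)) ⟩
  ∑[ c < k ] ∑[ i < v ] (δ (h c) i * g i)
    ≡⟨ ∑-comm (λ c i → δ (h c) i * g i) ⟩
  ∑[ i < v ] ∑[ c < k ] (δ (h c) i * g i)
    ≡⟨ sum-cong-≗ (λ i → *-distribʳ-sum (g i) (λ c → δ (h c) i)) ⟨
  ∑[ i < v ] ((∑[ c < k ] δ (h c) i) * g i)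
    ≤⟨ sum-mono-≤ (λ i → *-monoˡ-≤ (g i) (multiplicity-injective h h-inj i)) ⟩
  ∑[ i < v ] (1 * g i)
    ≡⟨ sum-cong-≗ (λ i → *-identityˡ (g i)) ⟩
  sum g ∎
  where open ≤-Reasoning

sum₂ : ∀ {v} → (Fin v → Fin v → ℕ) → ℕ
sum₂ {v} f = ∑[ i < v ] ∑[ j < v ] f i j

sum₂-+ : ∀ {v} (f g : Fin v → Fin v → ℕ) → sum₂ (λ i j → f i j + g i j) ≡ sum₂ f + sum₂ g
sum₂-+ {v} f g = trans (sum-cong-≗ (λ i → ∑-distrib-+ (f i) (g i))) (∑-distrib-+ (λ i → ∑[ j < v ] f i j) _)

count : ∀ {A : Set} → (A → Bool) → List A → ℕ
count P xs = length (filterᵇ P xs)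

count-++ : ∀ {A : Set} (P : A → Bool) xs ys → count P (xs ++ ys) ≡ count P xs + count P ys
count-++ P xs ys = trans (cong length (filter-++ (T? ∘ P) xs ys)) (length-++ (filterᵇ P xs))

count-tabulate : ∀ {A : Set} {v} (P : A → Bool) (f : Fin v → A) →
                 count P (tabulate f) ≡ ∑[ i < v ] ⟦ P (f i) ⟧
count-tabulate {v = zero}  P f = refl
count-tabulate {v = suc v} P f with P (f zero)
... | true  = cong suc (count-tabulate P (f ∘ suc))
... | false = count-tabulate P (f ∘ suc)

count-concat-tabulate : ∀ {A : Set} {v} (P : A → Bool) (g : Fin v → List A) →
                        count P (concat (tabulate g)) ≡ ∑[ i < v ] count P (g i)
count-concat-tabulate {v = zero}  P g = refl
count-concat-tabulate {v = suc v} P g =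
  trans (count-++ P (g zero) _) (cong (count P (g zero) +_) (count-concat-tabulate P (g ∘ suc)))

module _ {v : ℕ} (G : Graph v) where

  adjMatrix : Fin v → Fin v → ℕ
  adjMatrix i j = ⟦ adj G i j ⟧

  numEdges-double-sum : numEdges G ≡ ∑[ i < v ] ∑[ j < v ] ⟦ i <ᶠ j ∧ adj G i j ⟧
  numEdges-double-sum = begin
    count P (concat (map row (allFin v)))         ≡⟨ cong (count P ∘ concat) (map-tabulate id row) ⟩
    count P (concat (tabulate row))               ≡⟨ count-concat-tabulate P row ⟩
    ∑[ i < v ] count P (row i)                    ≡⟨ sum-cong-≗ (λ i → cong (count P) (map-tabulate id (i ,_))) ⟩
    ∑[ i < v ] count P (tabulate (i ,_))          ≡⟨ sum-cong-≗ (λ i → count-tabulate P (i ,_)) ⟩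
    ∑[ i < v ] ∑[ j < v ] ⟦ i <ᶠ j ∧ adj G i j ⟧ ∎
    where
    open ≡-Reasoning
    P : Fin v × Fin v → Bool
    P (i , j) = i <ᶠ j ∧ adj G i j
    row : Fin v → List (Fin v × Fin v)
    row i = map (i ,_) (allFin v)

  ordered-pairs-adjMatrix : ∀ i j → ⟦ i <ᶠ j ∧ adj G i j ⟧ + ⟦ j <ᶠ i ∧ adj G j i ⟧ ≡ adjMatrix i j
  ordered-pairs-adjMatrix i j with i ≟ j
  ... | yes refl rewrite irrefl G i | ∧-zeroʳ (i <ᶠ i) = refl
  ... | no i≢j = begin
    ⟦ i <ᶠ j ∧ adj G i j ⟧ + ⟦ j <ᶠ i ∧ adj G j i ⟧
      ≡⟨ cong₂ _+_ (⟦∧⟧ (i <ᶠ j) _) (⟦∧⟧ (j <ᶠ i) _) ⟩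
    ⟦ i <ᶠ j ⟧ * A + ⟦ j <ᶠ i ⟧ * adjMatrix j i
      ≡⟨ cong (λ b → ⟦ i <ᶠ j ⟧ * A + ⟦ j <ᶠ i ⟧ * ⟦ b ⟧) (Graph.sym G j i) ⟩
    ⟦ i <ᶠ j ⟧ * A + ⟦ j <ᶠ i ⟧ * A
      ≡⟨ *-distribʳ-+ A ⟦ i <ᶠ j ⟧ ⟦ j <ᶠ i ⟧ ⟨
    (⟦ i <ᶠ j ⟧ + ⟦ j <ᶠ i ⟧) * A
      ≡⟨ cong (_* A) (<ᶠ-exclusive i≢j) ⟩
    1 * A
      ≡⟨ *-identityˡ A ⟩
    A ∎
    where
    open ≡-Reasoning
    A = adjMatrix i j

  numEdges-twice : numEdges G + numEdges G ≡ sum₂ adjMatrix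
  numEdges-twice = begin
    numEdges G + numEdges G
      ≡⟨ cong₂ _+_ numEdges-double-sum (trans numEdges-double-sum (∑-comm ordered)) ⟩
    sum₂ ordered + ∑[ j < v ] ∑[ i < v ] ordered i j
      ≡⟨ ∑-distrib-+ (λ i → ∑[ j < v ] ordered i j) _ ⟨
    ∑[ i < v ] (∑[ j < v ] ordered i j + ∑[ j < v ] ordered j i)
      ≡⟨ sum-cong-≗ (λ i → ∑-distrib-+ (ordered i) (λ j → ordered j i)) ⟨
    ∑[ i < v ] ∑[ j < v ] (ordered i j + ordered j i)
      ≡⟨ sum-cong-≗ (λ i → sum-cong-≗ (ordered-pairs-adjMatrix i)) ⟩
    sum₂ adjMatrix ∎
    where
    open ≡-Reasoning
    ordered : Fin v → Fin v → ℕ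
    ordered i j = ⟦ i <ᶠ j ∧ adj G i j ⟧

-- Quadratic forms

module QuadraticForm {v : ℕ} (W : Fin v → Fin v → ℕ) (W-sym : ∀ a b → W b a ≡ W a b) where

  row : Fin v → (Fin v → ℕ) → ℕ
  row a w = ∑[ b < v ] (w b * W a b)

  form : (Fin v → ℕ) → (Fin v → ℕ) → ℕ
  form u w = ∑[ a < v ] (u a * row a w)

  row-+ : ∀ a {w w₁ w₂ : Fin v → ℕ} → (∀ b → w b ≡ w₁ b + w₂ b) → row a w ≡ row a w₁ + row a w₂
  row-+ a {w} {w₁} {w₂} w≡ = trans
    (sum-cong-≗ (λ b → trans (cong (_* W a b) (w≡ b)) (*-distribʳ-+ (W a b) (w₁ b) (w₂ b))))
    (∑-distrib-+ (λ b → w₁ b * W a b) _)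

  form-+ˡ : ∀ {u u₁ u₂ : Fin v → ℕ} w → (∀ a → u a ≡ u₁ a + u₂ a) → form u w ≡ form u₁ w + form u₂ w
  form-+ˡ {u} {u₁} {u₂} w u≡ = trans
    (sum-cong-≗ (λ a → trans (cong (_* row a w) (u≡ a)) (*-distribʳ-+ (row a w) (u₁ a) (u₂ a))))
    (∑-distrib-+ (λ a → u₁ a * row a w) _)

  form-+ʳ : ∀ u {w w₁ w₂ : Fin v → ℕ} → (∀ b → w b ≡ w₁ b + w₂ b) → form u w ≡ form u w₁ + form u w₂
  form-+ʳ u {w} {w₁} {w₂} w≡ = trans
    (sum-cong-≗ (λ a → trans (cong (u a *_) (row-+ a {w₁ = w₁} {w₂} w≡)) (*-distribˡ-+ (u a) (row a w₁) (row a w₂))))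
    (∑-distrib-+ (λ a → u a * row a w₁) _)

  form-expanded : ∀ u w → form u w ≡ ∑[ a < v ] ∑[ b < v ] (u a * (w b * W a b))
  form-expanded u w = sum-cong-≗ (λ a → *-distribˡ-sum (u a) (λ b → w b * W a b))

  form-sym : ∀ u w → form u w ≡ form w u
  form-sym u w = begin
    form u w                                       ≡⟨ form-expanded u w ⟩
    ∑[ a < v ] ∑[ b < v ] (u a * (w b * W a b))    ≡⟨ ∑-comm (λ a b → u a * (w b * W a b)) ⟩
    ∑[ b < v ] ∑[ a < v ] (u a * (w b * W a b))    ≡⟨ sum-cong-≗ (λ b → sum-cong-≗ (λ a → swap (u a) (w b) a b)) ⟩
    ∑[ b < v ] ∑[ a < v ] (w b * (u a * W b a))    ≡⟨ form-expanded w u ⟨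
    form w u                                       ∎
    where
    open ≡-Reasoning
    exchange : ∀ x y z → x * (y * z) ≡ y * (x * z)
    exchange = solve-∀
    swap : ∀ x y a b → x * (y * W a b) ≡ y * (x * W b a)
    swap x y a b = trans (cong (λ t → x * (y * t)) (sym (W-sym a b))) (exchange x y (W b a))

  𝟙 : (Fin v → Bool) → Fin v → ℕ
  𝟙 X i = ⟦ X i ⟧

  card : (Fin v → Bool) → ℕ
  card X = sum (𝟙 X)

  card-*-sum : ∀ X c → card X * c ≡ ∑[ i < v ] (⟦ X i ⟧ * c)
  card-*-sum X c = *-distribʳ-sum c (𝟙 X)

  full : Fin v → Bool
  full _ = true

  card-full : card full ≡ v
  card-full = trans (sum-const v 1) (*-identityʳ v)

  form-full : form (𝟙 full) (𝟙 full) ≡ sum₂ W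
  form-full = sum-cong-≗ (λ a → trans (*-identityˡ _) (sum-cong-≗ (λ b → *-identityˡ (W a b))))

  form-uniform-≥ : ∀ X c → (∀ a b → X a ≡ true → X b ≡ true → c ≤ W a b) →
                   card X * (card X * c) ≤ form (𝟙 X) (𝟙 X)
  form-uniform-≥ X c c≤W = begin
    card X * (card X * c)                   ≡⟨ card-*-sum X (card X * c) ⟩
    ∑[ a < v ] (⟦ X a ⟧ * (card X * c))     ≤⟨ sum-mono-≤ (λ a → ⟦⟧*-mono (X a) (c≤row a)) ⟩
    form (𝟙 X) (𝟙 X)                        ∎
    where
    open ≤-Reasoning
    c≤row : ∀ a → X a ≡ true → card X * c ≤ row a (𝟙 X)
    c≤row a Xa = begin
      card X * c                 ≡⟨ card-*-sum X c ⟩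
      ∑[ b < v ] (⟦ X b ⟧ * c)   ≤⟨ sum-mono-≤ (λ b → ⟦⟧*-mono (X b) (c≤W a b Xa)) ⟩
      row a (𝟙 X)                ∎

-- The blocks {x, p x} of a perfect matching

module Blocks {v : ℕ} {G : Graph v} (M : PerfectMatching G) where

  p : Fin v → Fin v
  p = partner M

  SameBlock : Fin v → Fin v → Set
  SameBlock x y = x ≡ y ⊎ x ≡ p y

  SameBlock-refl : ∀ x → SameBlock x x
  SameBlock-refl x = inj₁ refl

  SameBlock-partnerˡ : ∀ x → SameBlock (p x) x
  SameBlock-partnerˡ x = inj₂ refl

  SameBlock-partnerʳ : ∀ x → SameBlock x (p x)
  SameBlock-partnerʳ x = inj₂ (sym (invol M x))

  SameBlock-sym : ∀ {x y} → SameBlock x y → SameBlock y x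
  SameBlock-sym (inj₁ refl) = inj₁ refl
  SameBlock-sym (inj₂ refl) = SameBlock-partnerʳ _

  SameBlock-trans : ∀ {x y z} → SameBlock x y → SameBlock y z → SameBlock x z
  SameBlock-trans (inj₁ refl) yz          = yz
  SameBlock-trans (inj₂ refl) (inj₁ refl) = inj₂ refl
  SameBlock-trans (inj₂ refl) (inj₂ refl) = inj₁ (invol M _)

  SameBlock? : ∀ x y → Dec (SameBlock x y)
  SameBlock? x y = (x ≟ y) ⊎-dec (x ≟ p y)

  Separated : Fin v → Fin v → Set
  Separated x y = ¬ SameBlock x y

  Separated-sym : ∀ {x y} → Separated x y → Separated y x
  Separated-sym x≁y = x≁y ∘ SameBlock-sym

  -- The edges between the M-edges {x, p x} and {y, p y}; for y = x the M-edge is counted twice.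
  blockEdges : Fin v → Fin v → ℕ
  blockEdges x y = adjMatrix G x y + adjMatrix G x (p y) + adjMatrix G (p x) y + adjMatrix G (p x) (p y)

  blockEdges-partnerˡ : ∀ x y → blockEdges (p x) y ≡ blockEdges x y
  blockEdges-partnerˡ x y rewrite invol M x =
    swap-halves (adjMatrix G x y) (adjMatrix G x (p y)) (adjMatrix G (p x) y) (adjMatrix G (p x) (p y))
    where
    swap-halves : ∀ a b c d → c + d + a + b ≡ a + b + c + d
    swap-halves = solve-∀

  blockEdges-sym : ∀ x y → blockEdges y x ≡ blockEdges x y
  blockEdges-sym x y
    rewrite Graph.sym G y x | Graph.sym G y (p x) | Graph.sym G (p y) x | Graph.sym G (p y) (p x) =
    swap-middle (adjMatrix G x y) (adjMatrix G x (p y)) (adjMatrix G (p x) y) (adjMatrix G (p x) (p y))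
    where
    swap-middle : ∀ a b c d → a + c + b + d ≡ a + b + c + d
    swap-middle = solve-∀

  blockEdges-congˡ : ∀ {x x'} y → SameBlock x x' → blockEdges x y ≡ blockEdges x' y
  blockEdges-congˡ y (inj₁ refl) = refl
  blockEdges-congˡ y (inj₂ refl) = blockEdges-partnerˡ _ y

  blockEdges-cong : ∀ {x x' y y'} → SameBlock x x' → SameBlock y y' → blockEdges x y ≡ blockEdges x' y'
  blockEdges-cong {x} {x'} {y} {y'} xx' yy' = begin
    blockEdges x y    ≡⟨ blockEdges-congˡ y xx' ⟩
    blockEdges x' y   ≡⟨ blockEdges-sym y x' ⟩
    blockEdges y x'   ≡⟨ blockEdges-congˡ x' yy' ⟩
    blockEdges y' x'  ≡⟨ blockEdges-sym x' y' ⟩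
    blockEdges x' y'  ∎
    where open ≡-Reasoning

  blockEdges-self : ∀ x → blockEdges x x ≡ 2
  blockEdges-self x
    rewrite irrefl G x | irrefl G (p x) | isEdge M x | Graph.sym G (p x) x | isEdge M x = refl

  blockEdges-same : ∀ {x y} → SameBlock x y → blockEdges x y ≡ 2
  blockEdges-same {x} xy = trans (blockEdges-cong (SameBlock-refl x) (SameBlock-sym xy)) (blockEdges-self x)

  Sparse : Fin v → Fin v → Set
  Sparse x y = blockEdges x y ≤ 1

  Sparse-sym : ∀ {x y} → Sparse x y → Sparse y x
  Sparse-sym {x} {y} = subst (_≤ 1) (sym (blockEdges-sym x y))

  sparse⇒separated : ∀ {x y} → Sparse x y → Separated y x
  sparse⇒separated x-y y∼x with ≤-trans (≤-reflexive (sym (blockEdges-same (SameBlock-sym y∼x)))) x-y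
  ... | s≤s ()

  edge⇒blockEdges≥1 : ∀ x y → adj G x y ≡ true → 1 ≤ blockEdges x y
  edge⇒blockEdges≥1 x y xy rewrite xy = s≤s z≤n

  edges⇒blockEdges≥2 : ∀ x y → adj G x y ≡ true → adj G (p x) (p y) ≡ true → 2 ≤ blockEdges x y
  edges⇒blockEdges≥2 x y xy pxpy rewrite xy | pxpy =
    s≤s (≤-trans (s≤s z≤n) (m≤n+m _ (adjMatrix G x (p y) + adjMatrix G (p x) y)))

  sum₂-partnerˡ : ∀ f → sum₂ (λ x y → f (p x) y) ≡ sum₂ f
  sum₂-partnerˡ f = sym (sum-involution p (invol M) (λ x → ∑[ y < v ] f x y))

  sum₂-partnerʳ : ∀ f → sum₂ (λ x y → f x (p y)) ≡ sum₂ f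
  sum₂-partnerʳ f = sum-cong-≗ (λ x → sym (sum-involution p (invol M) (f x)))

  sum-blockEdges : sum₂ blockEdges ≡ 8 * numEdges G
  sum-blockEdges = begin
    sum₂ blockEdges
      ≡⟨ sum-cong-≗ (λ x → sum-cong-≗ (λ y → +-assoc (B x y) _ _)) ⟩
    sum₂ (λ x y → B x y + B (p x) y)
      ≡⟨ sum₂-+ B (λ x y → B (p x) y) ⟩
    sum₂ B + sum₂ (λ x y → B (p x) y)
      ≡⟨ cong (sum₂ B +_) (sum₂-partnerˡ B) ⟩
    sum₂ B + sum₂ B
      ≡⟨ cong (λ t → t + t) (trans (sum₂-+ A _) (cong (sum₂ A +_) (sum₂-partnerʳ A))) ⟩
    (sum₂ A + sum₂ A) + (sum₂ A + sum₂ A)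
      ≡⟨ cong (λ t → (t + t) + (t + t)) (numEdges-twice G) ⟨
    ((e + e) + (e + e)) + ((e + e) + (e + e))
      ≡⟨ eight-times e ⟩
    8 * e ∎
    where
    open ≡-Reasoning
    A = adjMatrix G
    B : Fin v → Fin v → ℕ
    B x y = A x y + A x (p y)
    e = numEdges G
    eight-times : ∀ e → ((e + e) + (e + e)) + ((e + e) + (e + e)) ≡ 8 * e
    eight-times = solve-∀

  oriented-matching-edges : ∑[ i < v ] ⟦ i <ᶠ p i ⟧ + ∑[ i < v ] ⟦ i <ᶠ p i ⟧ ≡ v
  oriented-matching-edges = begin
    S + S
      ≡⟨ cong (S +_) (sum-involution p (invol M) (λ i → ⟦ i <ᶠ p i ⟧)) ⟩
    S + ∑[ i < v ] ⟦ p i <ᶠ p (p i) ⟧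
      ≡⟨ cong (S +_) (sum-cong-≗ (λ i → cong (λ j → ⟦ p i <ᶠ j ⟧) (invol M i))) ⟩
    S + ∑[ i < v ] ⟦ p i <ᶠ i ⟧
      ≡⟨ ∑-distrib-+ (λ i → ⟦ i <ᶠ p i ⟧) _ ⟨
    ∑[ i < v ] (⟦ i <ᶠ p i ⟧ + ⟦ p i <ᶠ i ⟧)
      ≡⟨ sum-cong-≗ (λ i → <ᶠ-exclusive (noFix M i ∘ sym)) ⟩
    ∑[ i < v ] 1
      ≡⟨ trans (sum-const v 1) (*-identityʳ v) ⟩
    v ∎
    where
    open ≡-Reasoning
    S = ∑[ i < v ] ⟦ i <ᶠ p i ⟧

  matching-size : ∀ n → v ≡ n + n → ∑[ i < v ] ⟦ i <ᶠ p i ⟧ ≡ n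
  matching-size n v≡2n = *-cancelˡ-≡ _ n 2 (begin
    2 * S      ≡⟨ cong (S +_) (+-identityʳ S) ⟩
    S + S      ≡⟨ trans oriented-matching-edges v≡2n ⟩
    n + n      ≡⟨ cong (n +_) (+-identityʳ n) ⟨
    2 * n      ∎)
    where
    open ≡-Reasoning
    S = ∑[ i < v ] ⟦ i <ᶠ p i ⟧

  blockIndicator : Fin v → Fin v → ℕ
  blockIndicator x i = δ x i + δ (p x) i

  sum-blockIndicator : ∀ x (f : Fin v → ℕ) → ∑[ i < v ] (blockIndicator x i * f i) ≡ f x + f (p x)
  sum-blockIndicator x f =
    trans (sum-cong-≗ (λ i → *-distribʳ-+ (f i) (δ x i) (δ (p x) i)))
          (trans (∑-distrib-+ (λ i → δ x i * f i) _) (cong₂ _+_ (sum-δ x f) (sum-δ (p x) f)))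

  blockIndicator-size : ∀ x → ∑[ i < v ] blockIndicator x i ≡ 2
  blockIndicator-size x =
    trans (sum-cong-≗ (λ i → sym (*-identityʳ (blockIndicator x i)))) (sum-blockIndicator x (λ _ → 1))

  blockIndicator-inside : ∀ {i x} → SameBlock i x → blockIndicator x i ≡ 1
  blockIndicator-inside {x = x} (inj₁ refl)
    rewrite dec-true (x ≟ x) refl | dec-false (x ≟ p x) (noFix M x ∘ sym) = refl
  blockIndicator-inside {x = x} (inj₂ refl)
    rewrite dec-false (p x ≟ x) (noFix M x) | dec-true (p x ≟ p x) refl = refl

  blockIndicator-outside : ∀ {i x} → Separated i x → blockIndicator x i ≡ 0
  blockIndicator-outside {i} {x} i∉x
    rewrite dec-false (i ≟ x) (i∉x ∘ inj₁) | dec-false (i ≟ p x) (i∉x ∘ inj₂) = refl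

module BlockForm {v : ℕ} {G : Graph v} (M : PerfectMatching G) where
  open Blocks M
  open QuadraticForm blockEdges blockEdges-sym public

  Closed : (Fin v → Bool) → Set
  Closed X = ∀ i → X i ≡ X (p i)

  Closed-SameBlock : ∀ {X} → Closed X → ∀ {i j} → SameBlock i j → X i ≡ X j
  Closed-SameBlock closed (inj₁ refl)         = refl
  Closed-SameBlock closed {j = j} (inj₂ refl) = sym (closed j)

  TwoBlockCondition : Set
  TwoBlockCondition = ∀ x y → Sparse x y → ∀ w → Separated w x → Separated w y →
                      2 ≤ blockEdges x w + blockEdges y w

  row-blockIndicator : ∀ a x → row a (blockIndicator x) ≡ blockEdges a x + blockEdges a (p x)
  row-blockIndicator a x = sum-blockIndicator x (blockEdges a)

  form-blockIndicatorˡ : ∀ x w → form (blockIndicator x) w ≡ row x w + row (p x) w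
  form-blockIndicatorˡ x w = sum-blockIndicator x (λ a → row a w)

  blockEdges-to-block : ∀ a z → blockEdges a z + blockEdges a (p z) ≡ blockEdges z a + blockEdges z a
  blockEdges-to-block a z = cong₂ _+_ (blockEdges-sym z a) (trans (blockEdges-sym (p z) a) (blockEdges-partnerˡ z a))

  module RemoveTwoBlocks (two-block : TwoBlockCondition) (X : Fin v → Bool) (closed : Closed X)
                         (x y : Fin v) (Xx : X x ≡ true) (Xy : X y ≡ true) (sparse : Sparse x y) where

    removed : Fin v → Bool
    removed i = does (SameBlock? i x) ∨ does (SameBlock? i y)

    X' : Fin v → Bool
    X' i = not (removed i) ∧ X i

    r : Fin v → ℕ
    r i = blockIndicator x i + blockIndicator y i

    r≡removed : ∀ i → r i ≡ ⟦ removed i ⟧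
    r≡removed i = by-cases (SameBlock? i x) (SameBlock? i y)
      where
      by-cases : (i∼x? : Dec (SameBlock i x)) (i∼y? : Dec (SameBlock i y)) → r i ≡ ⟦ does i∼x? ∨ does i∼y? ⟧
      by-cases (yes i∼x) (yes i∼y) = ⊥-elim (sparse⇒separated sparse (SameBlock-trans (SameBlock-sym i∼y) i∼x))
      by-cases (yes i∼x) (no  i≁y) rewrite blockIndicator-inside i∼x  | blockIndicator-outside i≁y = refl
      by-cases (no  i≁x) (yes i∼y) rewrite blockIndicator-outside i≁x | blockIndicator-inside i∼y  = refl
      by-cases (no  i≁x) (no  i≁y) rewrite blockIndicator-outside i≁x | blockIndicator-outside i≁y = refl

    removed⊆X : ∀ i → removed i ≡ true → X i ≡ true
    removed⊆X i = by-cases (SameBlock? i x) (SameBlock? i y)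
      where
      by-cases : (i∼x? : Dec (SameBlock i x)) (i∼y? : Dec (SameBlock i y)) → does i∼x? ∨ does i∼y? ≡ true → X i ≡ true
      by-cases (yes i∼x) _         _ = trans (Closed-SameBlock closed i∼x) Xx
      by-cases (no _)    (yes i∼y) _ = trans (Closed-SameBlock closed i∼y) Xy
      by-cases (no _)    (no _)    ()

    X'-outside : ∀ a → X' a ≡ true → Separated a x × Separated a y
    X'-outside a = by-cases (SameBlock? a x) (SameBlock? a y)
      where
      by-cases : (a∼x? : Dec (SameBlock a x)) (a∼y? : Dec (SameBlock a y)) →
                 not (does a∼x? ∨ does a∼y?) ∧ X a ≡ true → Separated a x × Separated a y
      by-cases (yes _)  _        ()
      by-cases (no _)   (yes _)  ()
      by-cases (no a≁x) (no a≁y) _ = a≁x , a≁y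

    X'-closed : Closed X'
    X'-closed i = trans (cong₂ (λ b c → not (b ∨ c) ∧ X i) (partner-invariant x) (partner-invariant y))
                        (cong (not (removed (p i)) ∧_) (closed i))
      where
      partner-invariant : ∀ z → does (SameBlock? i z) ≡ does (SameBlock? (p i) z)
      partner-invariant z = does-⇔ (mk⇔ (SameBlock-trans (SameBlock-partnerˡ i)) (SameBlock-trans (SameBlock-partnerʳ i)))
                                   (SameBlock? i z) (SameBlock? (p i) z)

    X-split : ∀ i → ⟦ X i ⟧ ≡ ⟦ X' i ⟧ + r i
    X-split i = trans (⟦⟧-split (X i) (removed i) (removed⊆X i)) (cong (⟦ X' i ⟧ +_) (sym (r≡removed i)))

    card-split : card X ≡ card X' + 4
    card-split = trans (sum-cong-≗ X-split) (trans (∑-distrib-+ (𝟙 X') r)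
      (cong (card X' +_) (trans (∑-distrib-+ (blockIndicator x) (blockIndicator y))
                                (cong₂ _+_ (blockIndicator-size x) (blockIndicator-size y)))))

    row-r : ∀ a → row a r ≡ (blockEdges a x + blockEdges a (p x)) + (blockEdges a y + blockEdges a (p y))
    row-r a = trans (row-+ a {w₁ = blockIndicator x} {blockIndicator y} (λ _ → refl))
                    (cong₂ _+_ (row-blockIndicator a x) (row-blockIndicator a y))

    row-r-block-x : ∀ a → SameBlock a x → 4 ≤ row a r
    row-r-block-x a a∼x
      rewrite row-r a | blockEdges-same a∼x | blockEdges-same (SameBlock-trans a∼x (SameBlock-partnerʳ x)) = m≤m+n 4 _

    row-r-block-y : ∀ a → SameBlock a y → 4 ≤ row a r
    row-r-block-y a a∼y
      rewrite row-r a | blockEdges-same a∼y | blockEdges-same (SameBlock-trans a∼y (SameBlock-partnerʳ y)) = m≤n+m 4 _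

    row-r-outside : ∀ a → X' a ≡ true → 4 ≤ row a r
    row-r-outside a X'a = begin
      4                                          ≤⟨ +-mono-≤ two two ⟩
      (C x a + C y a) + (C x a + C y a)          ≡⟨ interchange (C x a) (C y a) ⟩
      (C x a + C x a) + (C y a + C y a)          ≡⟨ cong₂ _+_ (blockEdges-to-block a x) (blockEdges-to-block a y) ⟨
      (C a x + C a (p x)) + (C a y + C a (p y))  ≡⟨ row-r a ⟨
      row a r                                    ∎
      where
      open ≤-Reasoning
      C = blockEdges
      two = two-block x y sparse a (proj₁ (X'-outside a X'a)) (proj₂ (X'-outside a X'a))
      interchange : ∀ m n → (m + n) + (m + n) ≡ (m + m) + (n + n)
      interchange = solve-∀

    form-r-r : 16 ≤ form r r
    form-r-r = begin
      16
        ≤⟨ +-mono-≤ (+-mono-≤ (in-x x (SameBlock-refl x)) (in-x (p x) (SameBlock-partnerˡ x)))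
                    (+-mono-≤ (in-y y (SameBlock-refl y)) (in-y (p y) (SameBlock-partnerˡ y))) ⟩
      (row x r + row (p x) r) + (row y r + row (p y) r)
        ≡⟨ cong₂ _+_ (form-blockIndicatorˡ x r) (form-blockIndicatorˡ y r) ⟨
      form (blockIndicator x) r + form (blockIndicator y) r
        ≡⟨ form-+ˡ {u₁ = blockIndicator x} {blockIndicator y} r (λ _ → refl) ⟨
      form r r ∎
      where
      open ≤-Reasoning
      in-x = row-r-block-x
      in-y = row-r-block-y

    form-X'-r : card X' * 4 ≤ form (𝟙 X') r
    form-X'-r = begin
      card X' * 4                      ≡⟨ card-*-sum X' 4 ⟩
      ∑[ a < v ] (⟦ X' a ⟧ * 4)        ≤⟨ sum-mono-≤ (λ a → ⟦⟧*-mono (X' a) (row-r-outside a)) ⟩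
      form (𝟙 X') r                    ∎
      where open ≤-Reasoning

    form-split : form (𝟙 X) (𝟙 X) ≡ (form (𝟙 X') (𝟙 X') + form (𝟙 X') r) + (form r (𝟙 X') + form r r)
    form-split = trans (form-+ˡ {u₁ = 𝟙 X'} {r} (𝟙 X) X-split)
                       (cong₂ _+_ (form-+ʳ (𝟙 X') {w₁ = 𝟙 X'} {r} X-split) (form-+ʳ r {w₁ = 𝟙 X'} {r} X-split))

    quadratic-step : card X' * card X' ≤ form (𝟙 X') (𝟙 X') → card X * card X ≤ form (𝟙 X) (𝟙 X)
    quadratic-step ih = begin
      card X * card X
        ≡⟨ cong₂ _*_ card-split card-split ⟩
      (m + 4) * (m + 4)
        ≡⟨ square-expand m ⟩
      (m * m + m * 4) + (m * 4 + 16)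
        ≤⟨ +-mono-≤ (+-mono-≤ ih form-X'-r) (+-mono-≤ (≤-trans form-X'-r (≤-reflexive (form-sym (𝟙 X') r))) form-r-r) ⟩
      (form (𝟙 X') (𝟙 X') + form (𝟙 X') r) + (form r (𝟙 X') + form r r)
        ≡⟨ form-split ⟨
      form (𝟙 X) (𝟙 X) ∎
      where
      open ≤-Reasoning
      m = card X'
      square-expand : ∀ m → (m + 4) * (m + 4) ≡ (m * m + m * 4) + (m * 4 + 16)
      square-expand = solve-∀

  quadratic-bound : TwoBlockCondition → ∀ X → Closed X → card X * card X ≤ form (𝟙 X) (𝟙 X)
  quadratic-bound two-block X closed = <-rec P induct (card X) X closed refl
    where
    P : ℕ → Set
    P m = ∀ X → Closed X → card X ≡ m → card X * card X ≤ form (𝟙 X) (𝟙 X)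
    induct : ∀ m → (∀ {m'} → m' < m → P m') → P m
    induct m ih X closed refl
      with any? (λ x → any? (λ y → (X x ≟ᵇ true) ×-dec (X y ≟ᵇ true) ×-dec (blockEdges x y ≤? 1)))
    ... | yes (x , y , Xx , Xy , sparse) = quadratic-step (ih smaller X' X'-closed refl)
      where
      open RemoveTwoBlocks two-block X closed x y Xx Xy sparse
      smaller : card X' < card X
      smaller = subst (card X' <_) (sym card-split) (m<m+n (card X') (s≤s z≤n))
    ... | no no-sparse-pair =
      subst (_≤ form (𝟙 X) (𝟙 X)) (cong (card X *_) (*-identityʳ (card X))) (form-uniform-≥ X 1 dense)
      where
      dense : ∀ a b → X a ≡ true → X b ≡ true → 1 ≤ blockEdges a b
      dense a b Xa Xb with blockEdges a b ≤? 1
      ... | yes sparse  = ⊥-elim (no-sparse-pair (a , b , Xa , Xb , sparse))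
      ... | no  ¬sparse = ≤-trans (s≤s z≤n) (≰⇒> ¬sparse)

-- Forcing sets missing at most three blocks

module ForcingComplement {v : ℕ} {G : Graph v} (M : PerfectMatching G) {k : ℕ} (rep : Fin k → Fin v) where
  open Blocks M

  InRegion : Fin v → Set
  InRegion i = ∃ λ c → SameBlock i (rep c)

  InRegion? : ∀ i → Dec (InRegion i)
  InRegion? i = any? (λ c → SameBlock? i (rep c))

  InRegion-SameBlock : ∀ {i j} → SameBlock i j → InRegion j → InRegion i
  InRegion-SameBlock i∼j (c , j∼c) = c , SameBlock-trans i∼j j∼c

  complement : EdgeSubset M
  complement = record
    { mark   = λ i → not (does (InRegion? i))
    ; closed = λ i → cong not (does-⇔ (mk⇔ (InRegion-SameBlock (SameBlock-partnerˡ i))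
                                            (InRegion-SameBlock (SameBlock-partnerʳ i)))
                                       (InRegion? i) (InRegion? (p i)))
    }

  RepsSeparated : Set
  RepsSeparated = ∀ {c c'} → c ≢ c' → Separated (rep c) (rep c')

  RepsSparse : Set
  RepsSparse = ∀ {c c'} → c ≢ c' → Sparse (rep c) (rep c')

  RepsTriangleFree : Set
  RepsTriangleFree = ∀ {c₁ c₂ c₃} → c₁ ≢ c₂ → c₁ ≢ c₃ → c₂ ≢ c₃ →
                     1 ≤ blockEdges (rep c₁) (rep c₂) → 1 ≤ blockEdges (rep c₁) (rep c₃) →
                     1 ≤ blockEdges (rep c₂) (rep c₃) → ⊥

  module _ (distinct : RepsSeparated) where

    index-unique : ∀ {i c c'} → SameBlock i (rep c) → SameBlock i (rep c') → c ≡ c'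
    index-unique {c = c} {c'} i∼c i∼c' with c ≟ c'
    ... | yes c≡c' = c≡c'
    ... | no  c≢c' = ⊥-elim (distinct c≢c' (SameBlock-trans (SameBlock-sym i∼c) i∼c'))

    -- size counts every M-edge at its endpoint of smaller index; lower c is that endpoint.
    lower : Fin k → Fin v
    lower c with rep c <ᶠ p (rep c)
    ... | true  = rep c
    ... | false = p (rep c)

    lower-SameBlock : ∀ c → SameBlock (lower c) (rep c)
    lower-SameBlock c with rep c <ᶠ p (rep c)
    ... | true  = SameBlock-refl (rep c)
    ... | false = SameBlock-partnerˡ (rep c)

    lower-oriented : ∀ c → lower c <ᶠ p (lower c) ≡ true
    lower-oriented c with rep c <ᶠ p (rep c) in e
    ... | true  = e
    ... | false = subst (λ j → p (rep c) <ᶠ j ≡ true) (sym (invol M (rep c))) (<ᶠ-flip (noFix M (rep c) ∘ sym) e)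

    lower-injective : Injective _≡_ _≡_ lower
    lower-injective {c} {c'} e = index-unique (lower-SameBlock c) (subst (λ j → SameBlock j (rep c')) (sym e) (lower-SameBlock c'))

    region-edges≥k : k ≤ ∑[ i < v ] ⟦ does (InRegion? i) ∧ i <ᶠ p i ⟧
    region-edges≥k = begin
      k                                           ≡⟨ *-identityʳ k ⟨
      k * 1                                       ≡⟨ sum-const k 1 ⟨
      ∑[ c < k ] 1                                ≡⟨ sum-cong-≗ (λ c → sym (lower-counted c)) ⟩
      ∑[ c < k ] g (lower c)                      ≤⟨ sum-injective-≤ lower lower-injective g ⟩
      ∑[ i < v ] g i                              ∎
      where
      open ≤-Reasoning
      g : Fin v → ℕ
      g i = ⟦ does (InRegion? i) ∧ i <ᶠ p i ⟧
      lower-counted : ∀ c → g (lower c) ≡ 1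
      lower-counted c rewrite dec-true (InRegion? (lower c)) (c , lower-SameBlock c) | lower-oriented c = refl

    size-complement : ∀ n → v ≡ n + n → size complement + k ≤ n
    size-complement n v≡2n = begin
      size complement + k
        ≡⟨ cong (_+ k) (count-tabulate (λ i → mark complement i ∧ i <ᶠ p i) id) ⟩
      ∑[ i < v ] ⟦ mark complement i ∧ i <ᶠ p i ⟧ + k
        ≤⟨ +-monoʳ-≤ _ region-edges≥k ⟩
      ∑[ i < v ] ⟦ mark complement i ∧ i <ᶠ p i ⟧ + ∑[ i < v ] ⟦ does (InRegion? i) ∧ i <ᶠ p i ⟧
        ≡⟨ ∑-distrib-+ (λ i → ⟦ mark complement i ∧ i <ᶠ p i ⟧) _ ⟨
      ∑[ i < v ] (⟦ mark complement i ∧ i <ᶠ p i ⟧ + ⟦ does (InRegion? i) ∧ i <ᶠ p i ⟧)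
        ≡⟨ sum-cong-≗ (λ i → ⟦⟧-partition (i <ᶠ p i) (does (InRegion? i))) ⟩
      ∑[ i < v ] ⟦ i <ᶠ p i ⟧
        ≡⟨ matching-size n v≡2n ⟩
      n ∎
      where open ≤-Reasoning

    same-index⇒SameBlock : ∀ {i j c} → SameBlock i (rep c) → SameBlock j (rep c) → SameBlock i j
    same-index⇒SameBlock i∼c j∼c = SameBlock-trans i∼c (SameBlock-sym j∼c)

    separated⇒index-≢ : ∀ {i j c c'} → SameBlock i (rep c) → SameBlock j (rep c') → Separated i j → c ≢ c'
    separated⇒index-≢ i∼c j∼c' i≁j refl = i≁j (same-index⇒SameBlock i∼c j∼c')

    module _ (sparse : RepsSparse) (triangle-free : RepsTriangleFree) (k≤3 : k ≤ 3) where

      complement-forcing : IsForcing M complement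
      complement-forcing M' agree = agrees
        where
        q : Fin v → Fin v
        q = partner M'

        q-injective : Injective _≡_ _≡_ q
        q-injective {i} {j} e = trans (sym (invol M' i)) (trans (cong q e) (invol M' j))

        q-swap : ∀ {i j} → q i ≡ j → q j ≡ i
        q-swap {i} refl = invol M' i

        outside : ∀ i → ¬ InRegion i → q i ≡ p i
        outside i i∉ = agree i (cong not (dec-false (InRegion? i) i∉))

        q-region : ∀ {i} → InRegion i → InRegion (q i)
        q-region {i} i∈ with InRegion? (q i)
        ... | yes qi∈ = qi∈
        ... | no  qi∉ = ⊥-elim (qi∉ (InRegion-SameBlock (inj₂ qi≡pi) i∈))
          where
          qi≡pi : q i ≡ p i
          qi≡pi = trans (sym (invol M (q i))) (cong p (sym (trans (sym (invol M' i)) (outside (q i) qi∉))))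

        q-edge-joins : ∀ {i c c'} → SameBlock i (rep c) → SameBlock (q i) (rep c') → 1 ≤ blockEdges (rep c) (rep c')
        q-edge-joins {i} i∼c qi∼c' = subst (1 ≤_) (blockEdges-cong i∼c qi∼c') (edge⇒blockEdges≥1 i (q i) (isEdge M' i))

        -- Follow M' out of the block of x: b = q x, d = q (p x) and e = q (p b). If d lies in the
        -- block of x or of b, M' is not a matching or has two edges between two blocks; otherwise
        -- e lies in one of the (at most three) blocks met so far and only a triangle remains.
        crossing-impossible : ∀ {x a cb cd} → SameBlock x (rep a) → SameBlock (q x) (rep cb) →
                              SameBlock (q (p x)) (rep cd) → Separated (q x) x → ⊥
        crossing-impossible {x} {a} {cb} {cd} x∼a b∼cb d∼cd b≁x with cd ≟ a | cd ≟ cb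
        ... | yes refl | _ = d-in-x-block (same-index⇒SameBlock d∼cd x∼a)
          where
          d-in-x-block : SameBlock (q (p x)) x → ⊥
          d-in-x-block (inj₁ d≡x)  = b≁x (inj₂ (q-swap d≡x))
          d-in-x-block (inj₂ d≡px) = noFix M' (p x) d≡px
        ... | no _ | yes refl = d-in-b-block (same-index⇒SameBlock d∼cd b∼cb)
          where
          two-edges : q (p x) ≡ p (q x) → 2 ≤ blockEdges (rep a) (rep cb)
          two-edges d≡pb = subst (2 ≤_) (blockEdges-cong x∼a b∼cb)
            (edges⇒blockEdges≥2 x (q x) (isEdge M' x) (subst (λ j → adj G (p x) j ≡ true) d≡pb (isEdge M' (p x))))
          d-in-b-block : SameBlock (q (p x)) (q x) → ⊥
          d-in-b-block (inj₁ d≡b)  = noFix M x (q-injective d≡b)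
          d-in-b-block (inj₂ d≡pb) with ≤-trans (two-edges d≡pb) (sparse (separated⇒index-≢ x∼a b∼cb (Separated-sym b≁x)))
          ... | s≤s ()
        ... | no cd≢a | no cd≢cb = third-block (q-region (InRegion-SameBlock (SameBlock-partnerˡ (q x)) (cb , b∼cb)))
          where
          a≢cb : a ≢ cb
          a≢cb = separated⇒index-≢ x∼a b∼cb (Separated-sym b≁x)
          third-block : InRegion (q (p (q x))) → ⊥
          third-block (ce , e∼ce) with among-three k≤3 a≢cb (cd≢a ∘ sym) (cd≢cb ∘ sym) ce
          ... | inj₁ refl = e-in-x-block (same-index⇒SameBlock e∼ce x∼a)
            where
            e-in-x-block : SameBlock (q (p (q x))) x → ⊥
            e-in-x-block (inj₁ e≡x)  = noFix M (q x) (sym (q-swap e≡x))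
            e-in-x-block (inj₂ e≡px) = cd≢cb (index-unique d∼cd (SameBlock-trans (inj₂ (q-swap e≡px)) b∼cb))
          ... | inj₂ (inj₁ refl) = e-in-b-block (same-index⇒SameBlock e∼ce b∼cb)
            where
            e-in-b-block : SameBlock (q (p (q x))) (q x) → ⊥
            e-in-b-block (inj₁ e≡b)  = b≁x (inj₂ (trans (sym (invol M (q x))) (cong p (q-injective e≡b))))
            e-in-b-block (inj₂ e≡pb) = noFix M' (p (q x)) e≡pb
          ... | inj₂ (inj₂ refl) =
            triangle-free a≢cb (cd≢a ∘ sym) (cd≢cb ∘ sym)
              (q-edge-joins x∼a b∼cb)
              (q-edge-joins (SameBlock-trans (SameBlock-partnerˡ x) x∼a) d∼cd)
              (q-edge-joins (SameBlock-trans (SameBlock-partnerˡ (q x)) b∼cb) e∼ce)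

        no-crossing : ∀ {x} → InRegion x → Separated (q x) x → ⊥
        no-crossing {x} (a , x∼a) b≁x with q-region (a , x∼a) | q-region (InRegion-SameBlock (SameBlock-partnerˡ x) (a , x∼a))
        ... | _ , b∼cb | _ , d∼cd = crossing-impossible x∼a b∼cb d∼cd b≁x

        agrees : ∀ x → q x ≡ p x
        agrees x with InRegion? x
        ... | no  x∉ = outside x x∉
        ... | yes x∈ with SameBlock? (q x) x
        ...   | yes (inj₁ qx≡x)  = ⊥-elim (noFix M' x qx≡x)
        ...   | yes (inj₂ qx≡px) = qx≡px
        ...   | no  qx≁x         = ⊥-elim (no-crossing x∈ qx≁x)

-- The two cases F = n - 1 and F = n - 2

module MinimalForcing {n : ℕ} {G : Graph (n + n)} (M : PerfectMatching G) {F : ℕ}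
                      (F-minimal : ∀ S → IsForcing M S → F ≤ size S) where
  open Blocks M
  open BlockForm M using (TwoBlockCondition; card; form; 𝟙; full; card-full; form-full; form-uniform-≥; quadratic-bound)

  open ForcingComplement M using (RepsSeparated; RepsSparse; RepsTriangleFree)

  F+k≤n : ∀ {k} (rep : Fin k → Fin (n + n)) →
          RepsSeparated rep → RepsSparse rep → RepsTriangleFree rep → k ≤ 3 → F + k ≤ n
  F+k≤n {k} rep distinct sparse triangle-free k≤3 =
    ≤-trans (+-monoˡ-≤ k (F-minimal complement (complement-forcing distinct sparse triangle-free k≤3)))
            (size-complement distinct n refl)
    where open ForcingComplement M rep

  blocks-dense-if-F+1≡n : F + 1 ≡ n → ∀ x y → 2 ≤ blockEdges x y
  blocks-dense-if-F+1≡n F+1≡n x y with SameBlock? x y | 2 ≤? blockEdges x y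
  ... | yes x∼y | _       = ≤-reflexive (sym (blockEdges-same x∼y))
  ... | no  _   | yes two = two
  ... | no  x≁y | no  ¬two = case +-cancelˡ-≤ F 2 1 (subst (F + 2 ≤_) (sym F+1≡n) F+2≤n) of λ { (s≤s ()) }
    where
    rep : Fin 2 → Fin (n + n)
    rep 0F = x
    rep 1F = y
    F+2≤n : F + 2 ≤ n
    F+2≤n = F+k≤n rep (pairwise-Fin2 Separated Separated-sym rep x≁y)
                      (pairwise-Fin2 Sparse Sparse-sym rep (≤-pred (≰⇒> ¬two)))
                      (λ c₁≢c₂ c₁≢c₃ c₂≢c₃ _ _ _ → no-three-distinct ≤-refl c₁≢c₂ c₁≢c₃ c₂≢c₃)
                      (s≤s (s≤s z≤n))

  sparse-triple-impossible : F + 2 ≡ n → ∀ {x y z} → Separated x y → Separated x z → Separated y z →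
                             Sparse x y → Sparse x z → blockEdges y z ≡ 0 → ⊥
  sparse-triple-impossible F+2≡n {x} {y} {z} x≁y x≁z y≁z xy xz yz≡0 =
    case +-cancelˡ-≤ F 3 2 (subst (F + 3 ≤_) (sym F+2≡n) F+3≤n) of λ { (s≤s (s≤s ())) }
    where
    rep : Fin 3 → Fin (n + n)
    rep 0F = x
    rep 1F = y
    rep 2F = z
    unjoined : ∀ {c c'} → c ≢ 0F → c' ≢ 0F → c ≢ c' → blockEdges (rep c) (rep c') ≡ 0
    unjoined {0F} c≢0 _    _    = ⊥-elim (c≢0 refl)
    unjoined {_}  {0F} _ c'≢0 _ = ⊥-elim (c'≢0 refl)
    unjoined {1F} {1F} _ _ c≢c' = ⊥-elim (c≢c' refl)
    unjoined {2F} {2F} _ _ c≢c' = ⊥-elim (c≢c' refl)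
    unjoined {1F} {2F} _ _ _    = yz≡0
    unjoined {2F} {1F} _ _ _    = trans (blockEdges-sym y z) yz≡0
    joined-unjoined : ∀ {m} → 1 ≤ m → m ≡ 0 → ⊥
    joined-unjoined (s≤s _) ()
    triangle-free : RepsTriangleFree rep
    triangle-free c₁≢c₂ c₁≢c₃ c₂≢c₃ j₁₂ j₁₃ j₂₃ with among-three ≤-refl c₁≢c₂ c₁≢c₃ c₂≢c₃ 0F
    ... | inj₁ refl        = joined-unjoined j₂₃ (unjoined (c₁≢c₂ ∘ sym) (c₁≢c₃ ∘ sym) c₂≢c₃)
    ... | inj₂ (inj₁ refl) = joined-unjoined j₁₃ (unjoined c₁≢c₂ (c₂≢c₃ ∘ sym) c₁≢c₃)
    ... | inj₂ (inj₂ refl) = joined-unjoined j₁₂ (unjoined c₁≢c₃ c₂≢c₃ c₁≢c₂)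
    F+3≤n : F + 3 ≤ n
    F+3≤n = F+k≤n rep (pairwise-Fin3 Separated Separated-sym rep x≁y x≁z y≁z)
                      (pairwise-Fin3 Sparse Sparse-sym rep xy xz (subst (_≤ 1) (sym yz≡0) z≤n))
                      triangle-free ≤-refl

  two-block-condition-if-F+2≡n : F + 2 ≡ n → TwoBlockCondition
  two-block-condition-if-F+2≡n F+2≡n x y xy w w≁x w≁y with 2 ≤? blockEdges x w + blockEdges y w
  ... | yes two = two
  ... | no ¬two = ⊥-elim (one-side-unjoined (≤-pred (≰⇒> ¬two)))
    where
    y≁x = sparse⇒separated xy
    one-side-unjoined : blockEdges x w + blockEdges y w ≤ 1 → ⊥
    one-side-unjoined sum≤1 with sum≤1⇒zero (blockEdges x w) (blockEdges y w) sum≤1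
    ... | inj₁ xw≡0 = sparse-triple-impossible F+2≡n y≁x (Separated-sym w≁y) (Separated-sym w≁x)
                        (Sparse-sym xy) (≤-trans (m≤n+m _ (blockEdges x w)) sum≤1) xw≡0
    ... | inj₂ yw≡0 = sparse-triple-impossible F+2≡n (Separated-sym y≁x) (Separated-sym w≁x) (Separated-sym w≁y)
                        xy (≤-trans (m≤m+n _ (blockEdges y w)) sum≤1) yw≡0

  numEdges-bound-if-F+1≡n : F + 1 ≡ n → n * n ≤ numEdges G
  numEdges-bound-if-F+1≡n F+1≡n = *-cancelˡ-≤ 8 (begin
    8 * (n * n)                             ≡⟨ eight-squares n ⟩
    (n + n) * ((n + n) * 2)                 ≡⟨ cong (λ m → m * (m * 2)) card-full ⟨
    card full * (card full * 2)             ≤⟨ form-uniform-≥ full 2 (λ a b _ _ → blocks-dense-if-F+1≡n F+1≡n a b) ⟩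
    form (𝟙 full) (𝟙 full)                  ≡⟨ form-full ⟩
    sum₂ blockEdges                         ≡⟨ sum-blockEdges ⟩
    8 * numEdges G                          ∎)
    where
    open ≤-Reasoning
    eight-squares : ∀ n → 8 * (n * n) ≡ (n + n) * ((n + n) * 2)
    eight-squares = solve-∀

  numEdges-bound-if-F+2≡n : F + 2 ≡ n → n * n ≤ 2 * numEdges G
  numEdges-bound-if-F+2≡n F+2≡n = *-cancelˡ-≤ 4 (begin
    4 * (n * n)                             ≡⟨ four-squares n ⟩
    (n + n) * (n + n)                       ≡⟨ cong (λ m → m * m) card-full ⟨
    card full * card full                   ≤⟨ quadratic-bound (two-block-condition-if-F+2≡n F+2≡n) full (λ _ → refl) ⟩
    form (𝟙 full) (𝟙 full)                  ≡⟨ form-full ⟩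
    sum₂ blockEdges                         ≡⟨ sum-blockEdges ⟩
    8 * numEdges G                          ≡⟨ *-assoc 4 2 (numEdges G) ⟩
    4 * (2 * numEdges G)                    ∎)
    where
    open ≤-Reasoning
    four-squares : ∀ n → 4 * (n * n) ≡ (n + n) * (n + n)
    four-squares = solve-∀

proposition5p3 : (n : ℕ) (G : Graph (n + n)) → PerfectMatching G →
                 (F : ℕ) → MaxForcingNumber G F →
                 (F + 1 ≡ n ⊎ F + 2 ≡ n) →
                 n * n ≤ (n ∸ F) * numEdges G
proposition5p3 n G _ F ((M , _ , F-minimal) , _) (inj₁ F+1≡n) = begin
  n * n                  ≤⟨ numEdges-bound-if-F+1≡n F+1≡n ⟩
  numEdges G             ≡⟨ *-identityˡ (numEdges G) ⟨
  1 * numEdges G         ≡⟨ cong (_* numEdges G) (∸-of-+ F+1≡n) ⟨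
  (n ∸ F) * numEdges G   ∎
  where
  open ≤-Reasoning
  open MinimalForcing {n} M F-minimal
proposition5p3 n G _ F ((M , _ , F-minimal) , _) (inj₂ F+2≡n) = begin
  n * n                  ≤⟨ numEdges-bound-if-F+2≡n F+2≡n ⟩
  2 * numEdges G         ≡⟨ cong (_* numEdges G) (∸-of-+ F+2≡n) ⟨
  (n ∸ F) * numEdges G   ∎
  where
  open ≤-Reasoning
  open MinimalForcing {n} M F-minimal
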